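{- For all strictly positive formulas $A,B$ and all $m<n$, the following equivalences are provable in $\mathrm{RC}^\nabla$: (i) $\Diamond_n(A\land\nabla_mB)=\Diamond_nA\land\Diamond_mB$; (ii) $\nabla_n(A\land\Diamond_mB)=\nabla_nA\land\Diamond_mB$.
   Context: Strictly positive formulas are built from propositional variables and $\top$ by $\land$ and unary modalities $\Diamond_n,\nabla_n$ ($n<\omega$). $\mathrm{RC}^\nabla$ is the smallest set of sequents $A\vdash B$ containing the following axioms and closed under the following rules and under substitution: (1) $A\vdash A$; $A\vdash\top$; $A\land B\vdash A$; $A\land B\vdash B$; from $A\vdash B$, $B\vdash C$ infer $A\vdash C$; from $A\vdash B$, $A\vdash C$ infer $A\vdash B\land C$; from $A\vdash B$ infer $aA\vdash aB$ for each modality $a$; (2) $aaA\vdash aA$ for each modality $a$; (3) for $m<n$: $\Diamond_nA\vdash\Diamond_mA$, $\Diamond_nA\land\Diamond_mB\vdash\Diamond_n(A\land\Diamond_mB)$, and the same two with $\nabla$ in place of $\Diamond$; (4) $A\vdash\nabla_nA$, $\Diamond_nA\vdash\nabla_nA$; (5) for $m\le n$: $\Diamond_m\nabla_nA\vdash\Diamond_mA$, $\nabla_n\Diamond_mA\vdash\Diamond_mA$. $A=B$ means both $A\vdash B$ and $B\vdash A$ are provable. -}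

module Defs where

open import Data.Nat using (ℕ; _<_; _≤_)
open import Data.Product using (_×_)

data Mod : Set where
  ◇ : ℕ → Mod
  ∇ : ℕ → Mod

data Fm : Set where
  var : ℕ → Fm
  ⊤   : Fm
  _∧_ : Fm → Fm → Fm
  ⟨_⟩_ : Mod → Fm → Fm

infixr 6 _∧_
infix 7 ⟨_⟩_

-- Provability of sequents A ⊢ B in RC^∇.  Axioms are given as schemata over
-- arbitrary formulas, so the set of derivable sequents is closed under substitution.
data _⊢_ : Fm → Fm → Set where
  refl⊢  : ∀ {A} → A ⊢ A
  top    : ∀ {A} → A ⊢ ⊤
  ∧E₁    : ∀ {A B} → (A ∧ B) ⊢ A
  ∧E₂    : ∀ {A B} → (A ∧ B) ⊢ B
  cut    : ∀ {A B C} → A ⊢ B → B ⊢ C → A ⊢ C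
  ∧I     : ∀ {A B C} → A ⊢ B → A ⊢ C → A ⊢ (B ∧ C)
  mono   : ∀ {A B} (a : Mod) → A ⊢ B → ⟨ a ⟩ A ⊢ ⟨ a ⟩ B
  trans4 : ∀ {A} (a : Mod) → ⟨ a ⟩ ⟨ a ⟩ A ⊢ ⟨ a ⟩ A
  ◇mono  : ∀ {A m n} → m < n → ⟨ ◇ n ⟩ A ⊢ ⟨ ◇ m ⟩ A
  ◇J     : ∀ {A B m n} → m < n →
           (⟨ ◇ n ⟩ A ∧ ⟨ ◇ m ⟩ B) ⊢ ⟨ ◇ n ⟩ (A ∧ ⟨ ◇ m ⟩ B)
  ∇mono  : ∀ {A m n} → m < n → ⟨ ∇ n ⟩ A ⊢ ⟨ ∇ m ⟩ A
  ∇J     : ∀ {A B m n} → m < n →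
           (⟨ ∇ n ⟩ A ∧ ⟨ ∇ m ⟩ B) ⊢ ⟨ ∇ n ⟩ (A ∧ ⟨ ∇ m ⟩ B)
  ∇refl  : ∀ {A n} → A ⊢ ⟨ ∇ n ⟩ A
  ◇∇     : ∀ {A n} → ⟨ ◇ n ⟩ A ⊢ ⟨ ∇ n ⟩ A
  ◇∇abs  : ∀ {A m n} → m ≤ n → ⟨ ◇ m ⟩ ⟨ ∇ n ⟩ A ⊢ ⟨ ◇ m ⟩ A
  ∇◇abs  : ∀ {A m n} → m ≤ n → ⟨ ∇ n ⟩ ⟨ ◇ m ⟩ A ⊢ ⟨ ◇ m ⟩ A

infix 4 _⊢_ _≡RC_

_≡RC_ : Fm → Fm → Set
A ≡RC B = (A ⊢ B) × (B ⊢ A)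

-- Both equivalences reduce to the joining axioms ◇J/∇J together with the absorption
-- laws (5): since m < n, a ∇ₘ directly below ◇ₙ can be absorbed after weakening ◇ₙ to ◇ₘ,
-- and a ◇ₘ below ∇ₙ is absorbed outright. For the joining direction of (ii), ◇ₘB is first
-- raised to ∇ₘ◇ₘB so that ∇J applies, and the resulting ∇ₘ◇ₘB is absorbed back to ◇ₘB.
module Submission where

open import Defs
open import Data.Nat using (ℕ; _<_)
open import Data.Nat.Properties using (≤-refl; <⇒≤)
open import Data.Product using (_×_; _,_)

private
  variable
    A A′ B B′ : Fm
    m n : ℕ

∧-map : A ⊢ A′ → B ⊢ B′ → A ∧ B ⊢ A′ ∧ B′
∧-map f g = ∧I (cut ∧E₁ f) (cut ∧E₂ g)

∧-mapʳ : B ⊢ B′ → A ∧ B ⊢ A ∧ B′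
∧-mapʳ = ∧-map refl⊢

⟨⟩-∧-distrib : (a : Mod) → ⟨ a ⟩ (A ∧ B) ⊢ ⟨ a ⟩ A ∧ ⟨ a ⟩ B
⟨⟩-∧-distrib a = ∧I (mono a ∧E₁) (mono a ∧E₂)

◇∇-absorb : m < n → ⟨ ◇ n ⟩ ⟨ ∇ m ⟩ A ⊢ ⟨ ◇ m ⟩ A
◇∇-absorb m<n = cut (◇mono m<n) (◇∇abs ≤-refl)

◇-∧-∇-split : m < n → ⟨ ◇ n ⟩ (A ∧ ⟨ ∇ m ⟩ B) ⊢ ⟨ ◇ n ⟩ A ∧ ⟨ ◇ m ⟩ B
◇-∧-∇-split {n = n} m<n = cut (⟨⟩-∧-distrib (◇ n)) (∧-mapʳ (◇∇-absorb m<n))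

◇-∧-∇-join : m < n → ⟨ ◇ n ⟩ A ∧ ⟨ ◇ m ⟩ B ⊢ ⟨ ◇ n ⟩ (A ∧ ⟨ ∇ m ⟩ B)
◇-∧-∇-join {n = n} m<n = cut (◇J m<n) (mono (◇ n) (∧-mapʳ ◇∇))

∇-∧-◇-split : m < n → ⟨ ∇ n ⟩ (A ∧ ⟨ ◇ m ⟩ B) ⊢ ⟨ ∇ n ⟩ A ∧ ⟨ ◇ m ⟩ B
∇-∧-◇-split {n = n} m<n = cut (⟨⟩-∧-distrib (∇ n)) (∧-mapʳ (∇◇abs (<⇒≤ m<n)))

∇-∧-◇-join : m < n → ⟨ ∇ n ⟩ A ∧ ⟨ ◇ m ⟩ B ⊢ ⟨ ∇ n ⟩ (A ∧ ⟨ ◇ m ⟩ B)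
∇-∧-◇-join {n = n} m<n =
  cut (∧-mapʳ ∇refl) (cut (∇J m<n) (mono (∇ n) (∧-mapʳ (∇◇abs ≤-refl))))

lemma2 : (A B : Fm) (m n : ℕ) → m < n →
    (⟨ ◇ n ⟩ (A ∧ ⟨ ∇ m ⟩ B) ≡RC (⟨ ◇ n ⟩ A ∧ ⟨ ◇ m ⟩ B))
    × (⟨ ∇ n ⟩ (A ∧ ⟨ ◇ m ⟩ B) ≡RC (⟨ ∇ n ⟩ A ∧ ⟨ ◇ m ⟩ B))
lemma2 A B m n m<n =
    (◇-∧-∇-split m<n , ◇-∧-∇-join m<n)
  , (∇-∧-◇-split m<n , ∇-∧-◇-join m<n)
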